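{- Let $B$ be a bipartite circuit graph with outer cycle $C$ such that all internal vertices of $B$ have degree at least $4$. Then $B$ has at least $4$ external vertices of degree $2$.
   Context: A plane graph is a graph with a fixed planar embedding; vertices and edges incident to the unbounded face are external, all others internal. For a plane graph $G$, $G^+$ is obtained by adding a new vertex adjacent to all external vertices; $G$ is a circuit graph if $G^+$ is $3$-connected. A circuit graph is 2-connected and its unbounded face is bounded by a cycle, its outer cycle. -}

module Defs where

open import Data.Nat using (ℕ; zero; suc; _+_; _*_; _≤_; _<_; _≤ᵇ_)
open import Data.Fin using (Fin; zero; suc; toℕ; _≟_)
open import Data.Bool using (Bool; true; false; if_then_else_; _∧_)
open import Data.List using (List; length)
open import Data.List.Membership.Propositional using (_∉_)
open import Data.Product using (Σ; _×_; ∃)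
open import Data.Empty using (⊥)
open import Relation.Binary.PropositionalEquality using (_≡_; _≢_)
open import Relation.Nullary.Decidable using (⌊_⌋)

iter : {A : Set} → (A → A) → ℕ → A → A
iter f zero    x = x
iter f (suc k) x = f (iter f k x)

countF : ∀ {d} → (Fin d → Bool) → ℕ
countF {zero}  p = 0
countF {suc d} p = (if p zero then 1 else 0) + countF (λ i → p (suc i))

allBelow : ℕ → (ℕ → Bool) → Bool
allBelow zero    p = true
allBelow (suc d) p = allBelow d p ∧ p d

module _ {N : ℕ} (Adj : Fin N → Fin N → Set) where

  data ReachIn (Allowed : Fin N → Set) : Fin N → Fin N → Set where
    here : ∀ {u} → Allowed u → ReachIn Allowed u u
    step : ∀ {u w v} → Allowed u → Adj u w → ReachIn Allowed w v →
           ReachIn Allowed u v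

  KConnected : ℕ → Set
  KConnected k =
    (k < N) ×
    (∀ (S : List (Fin N)) → length S < k →
       ∀ u v → u ∉ S → v ∉ S → ReachIn (λ w → w ∉ S) u v)

-- Plane graphs as combinatorial maps (rotation systems).
-- Vertices are Fin n, darts (half-edges) are Fin d.  Each edge consists of
-- two darts exchanged by the fixed-point-free involution rev; 'next' is the
-- rotation (cyclic order of darts around their common tail vertex, given
-- by the embedding).  Faces are the orbits of  φ = next ∘ rev.
-- The embedding is planar (spherical) iff Euler's formula  n - e + f = 2
-- holds, with e = d/2 edges and f faces (for connected graphs).
-- The unbounded face is specified by a dart 'outer' on its boundary.

record PlaneGraph (n d : ℕ) : Set where
  field
    tail  : Fin d → Fin n
    rev   : Fin d → Fin d
    next  : Fin d → Fin d
    prev  : Fin d → Fin d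
    outer : Fin d
    rev-invol : ∀ x → rev (rev x) ≡ x
    rev-nofix : ∀ x → rev x ≢ x
    next-prev : ∀ x → next (prev x) ≡ x
    prev-next : ∀ x → prev (next x) ≡ x
    next-tail : ∀ x → tail (next x) ≡ tail x
    next-cyc  : ∀ x y → tail x ≡ tail y → ∃ λ k → iter next k x ≡ y
    tail-surj : ∀ v → ∃ λ x → tail x ≡ v
    no-loop   : ∀ x → tail (rev x) ≢ tail x
    no-multi  : ∀ x y → tail x ≡ tail y → tail (rev x) ≡ tail (rev y) → x ≡ y

  head : Fin d → Fin n
  head x = tail (rev x)

  φ : Fin d → Fin d
  φ x = next (rev x)

  isFaceRep : Fin d → Bool
  isFaceRep x = allBelow d (λ k → toℕ x ≤ᵇ toℕ (iter φ k x))

  numFaces : ℕ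
  numFaces = countF isFaceRep

  field
    -- Euler's formula  n - d/2 + f = 2  (planarity of the embedding)
    euler : 2 * n + 2 * numFaces ≡ 4 + d

  Adj : Fin n → Fin n → Set
  Adj u v = ∃ λ x → tail x ≡ u × head x ≡ v

  degree : Fin n → ℕ
  degree v = countF (λ x → ⌊ tail x ≟ v ⌋)

  -- external vertices: those on the boundary of the unbounded face
  External : Fin n → Set
  External v = ∃ λ k → tail (iter φ k outer) ≡ v

  Internal : Fin n → Set
  Internal v = External v → ⊥

  -- G⁺ : vertex 'zero' is the new vertex, 'suc v' is the old vertex v
  AdjPlus : Fin (suc n) → Fin (suc n) → Set
  AdjPlus zero    zero    = ⊥
  AdjPlus zero    (suc v) = External v
  AdjPlus (suc u) zero    = External u
  AdjPlus (suc u) (suc v) = Adj u v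

  IsCircuitGraph : Set
  IsCircuitGraph = KConnected AdjPlus 3

  IsBipartite : Set
  IsBipartite = Σ (Fin n → Bool) λ c → ∀ x → c (tail x) ≢ c (head x)

-- Charge counting against Euler's formula (d = 2e darts, f faces). As G⁺ is 3-connected,
-- every vertex has degree at least 2; with internal degrees at least 4 this gives
-- 4 ≤ deg v + [v external] + [v external of degree 2] for every vertex v, and summing gives
-- 4n ≤ d + X + K, where X counts the external vertices and K those of degree 2. A face of a
-- simple bipartite graph without vertices of degree 1 has at least 4 darts, and the outer
-- face has at least X, so 4f + X ≤ d + 4. Adding the two bounds and using 2n + 2f = d + 4
-- leaves K ≥ 4.
module Submission where

open import Defs
open import Data.Nat.Properties
  using ( ≤-refl; ≤-trans; ≤-<-trans; ≤-antisym; <⇒≤; ≤-pred; ≤ᵇ⇒≤; ≤∧≢⇒<; <-cmp; n<1+n; m≤m+n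
        ; m≤n⇒m<n∨m≡n; +-assoc; +-comm; *-suc; *-identityʳ; *-zeroʳ
        ; +-mono-≤; +-monoˡ-≤; +-cancelˡ-≤
        ; m∸n≤m; m∸n+n≡m; m+[n∸m]≡n; m<n⇒0<n∸m; +-*-semiring; ≤-totalOrder; module ≤-Reasoning)
open import Algebra.Properties.Semiring.Sum +-*-semiring
  using (sum; sum-syntax; ∑-comm; ∑-distrib-+; *-distribˡ-sum; sum-cong-≗; sum-remove)
open import Data.Bool using (Bool; true; false; if_then_else_; T; not; _∧_)
open import Data.Bool.Properties using (T-∧; not-¬; ¬-not; not-involutive)
open import Data.Fin using (Fin; zero; suc; toℕ; fromℕ<; inject≤; punchIn; _≟_)
open import Data.Fin.Properties
  using ( suc-injective; toℕ-injective; toℕ<n; toℕ-fromℕ<; inject≤-injective; injective⇒≤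
        ; pigeonhole; any?)
open import Data.List using (List; []; _∷_; map; upTo)
open import Data.List.Extrema ≤-totalOrder using (argmin; argmin-all; f[argmin]≤f[xs])
open import Data.List.Membership.Propositional using (_∉_)
open import Data.List.Membership.Propositional.Properties using (∈-map⁺; ∈-upTo⁺)
open import Data.List.Relation.Unary.All using (universal; lookup)
import Data.List.Relation.Unary.All.Properties as All
open import Data.List.Relation.Unary.Any using (here; there)
open import Data.Nat using (ℕ; zero; suc; _+_; _*_; _∸_; _≤_; _<_; _≥_; _≤?_; z≤n; s≤s)
import Data.Nat as ℕ
open import Data.Nat.DivMod using (_%_; _/_; m≡m%n+[m/n]*n; m%n<n)
open import Data.Nat.Tactic.RingSolver using (solve)
open import Data.Product using (Σ; ∃; _×_; _,_; proj₁; proj₂)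
open import Data.Sum using (inj₁; inj₂)
open import Function using (_∘_)
open import Function.Bundles using (Equivalence)
open import Function.Definitions using (Injective)
open import Relation.Binary.Definitions using (tri<; tri≈; tri>)
open import Relation.Binary.PropositionalEquality
open import Relation.Nullary using (¬_; Dec; yes; no; contradiction)
open import Relation.Nullary.Decidable using (⌊_⌋; map′; toWitness; fromWitness)

enumerate : ∀ {n} (P : Fin n → Bool) → Fin (countF P) → Fin n
enumerate {suc n} P i with P zero
enumerate {suc n} P zero    | true  = zero
enumerate {suc n} P (suc i) | true  = suc (enumerate (P ∘ suc) i)
enumerate {suc n} P i       | false = suc (enumerate (P ∘ suc) i)

rank : ∀ {n} (P : Fin n → Bool) (a : Fin n) → T (P a) → Fin (countF P)
rank {suc n} P zero with P zero
... | true  = λ _ → zero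
... | false = λ ()
rank {suc n} P (suc a) with P zero
... | true  = suc ∘ rank (P ∘ suc) a
... | false = rank (P ∘ suc) a

enumerate-sound : ∀ {n} (P : Fin n → Bool) i → T (P (enumerate P i))
enumerate-sound {suc n} P i with P zero in eq
enumerate-sound {suc n} P zero    | true  rewrite eq = _
enumerate-sound {suc n} P (suc i) | true  = enumerate-sound (P ∘ suc) i
enumerate-sound {suc n} P i       | false = enumerate-sound (P ∘ suc) i

enumerate-rank : ∀ {n} (P : Fin n → Bool) a (p : T (P a)) → enumerate P (rank P a p) ≡ a
enumerate-rank {suc n} P zero with P zero
... | true  = λ _ → refl
... | false = λ ()
enumerate-rank {suc n} P (suc a) with P zero
... | true  = cong suc ∘ enumerate-rank (P ∘ suc) a
... | false = cong suc ∘ enumerate-rank (P ∘ suc) a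

enumerate-injective : ∀ {n} (P : Fin n → Bool) i j → enumerate P i ≡ enumerate P j → i ≡ j
enumerate-injective {suc n} P i j with P zero
enumerate-injective {suc n} P zero    zero    | true = λ _ → refl
enumerate-injective {suc n} P zero    (suc j) | true = λ ()
enumerate-injective {suc n} P (suc i) zero    | true = λ ()
enumerate-injective {suc n} P (suc i) (suc j) | true =
  cong suc ∘ enumerate-injective (P ∘ suc) i j ∘ suc-injective
enumerate-injective {suc n} P i j | false = enumerate-injective (P ∘ suc) i j ∘ suc-injective

injective⇒≤countF : ∀ {k n} (P : Fin n → Bool) (f : Fin k → Fin n) →
                    Injective _≡_ _≡_ f → (∀ i → T (P (f i))) → k ≤ countF P
injective⇒≤countF P f f-injective f-sound =
  injective⇒≤ λ {i} {j} eq → f-injective (begin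
    f i                                       ≡⟨ enumerate-rank P (f i) (f-sound i) ⟨
    enumerate P (rank P (f i) (f-sound i))    ≡⟨ cong (enumerate P) eq ⟩
    enumerate P (rank P (f j) (f-sound j))    ≡⟨ enumerate-rank P (f j) (f-sound j) ⟩
    f j                                       ∎)
  where open ≡-Reasoning

≤countF⇒injection : ∀ {k n} (P : Fin n → Bool) → k ≤ countF P →
                    Σ (Fin k → Fin n) λ f → Injective _≡_ _≡_ f × (∀ i → T (P (f i)))
≤countF⇒injection P k≤count =
  enumerate P ∘ choice ,
  (λ eq → inject≤-injective k≤count k≤count _ _ (enumerate-injective P _ _ eq)) ,
  enumerate-sound P ∘ choice
  where choice = λ i → inject≤ i k≤count

indicator : Bool → ℕ
indicator b = if b then 1 else 0

countF-sum : ∀ {m} (p : Fin m → Bool) → countF p ≡ ∑[ i < m ] indicator (p i)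
countF-sum {zero}  p = refl
countF-sum {suc m} p = cong (indicator (p zero) +_) (countF-sum (p ∘ suc))

sum-mono-≤ : ∀ {m} (f g : Fin m → ℕ) → (∀ i → f i ≤ g i) → sum f ≤ sum g
sum-mono-≤ {zero}  f g f≤g = z≤n
sum-mono-≤ {suc m} f g f≤g = +-mono-≤ (f≤g zero) (sum-mono-≤ (f ∘ suc) (g ∘ suc) (f≤g ∘ suc))

sum-≤-exchange : ∀ {m} (f g : Fin m → ℕ) (i : Fin m) {a b} →
                 (∀ j → f j ≤ g j) → f i ≤ a → b ≤ g i → sum f + b ≤ a + sum g
sum-≤-exchange {suc m} f g i {a} {b} f≤g fi≤a b≤gi = begin
  sum f + b                        ≡⟨ cong (_+ b) (sum-remove {i = i} f) ⟩
  f i + sum (f ∘ punchIn i) + b    ≤⟨ +-mono-≤ (+-mono-≤ fi≤a (sum-mono-≤ _ _ (f≤g ∘ punchIn i))) b≤gi ⟩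
  a + sum (g ∘ punchIn i) + g i    ≡⟨ +-assoc a _ (g i) ⟩
  a + (sum (g ∘ punchIn i) + g i)  ≡⟨ cong (a +_) (+-comm _ (g i)) ⟩
  a + (g i + sum (g ∘ punchIn i))  ≡⟨ cong (a +_) (sum-remove {i = i} g) ⟨
  a + sum g                        ∎
  where open ≤-Reasoning

sum-const : ∀ m k → ∑[ i < m ] k ≡ m * k
sum-const zero    k = refl
sum-const (suc m) k = cong (k +_) (sum-const m k)

sum-indicator-≟ : ∀ {m} (z : Fin m) → ∑[ y < m ] indicator ⌊ z ≟ y ⌋ ≡ 1
sum-indicator-≟ {suc m} zero    = cong suc (trans (sum-const m 0) (*-zeroʳ m))
sum-indicator-≟ {suc m} (suc z) =
  trans (sum-cong-≗ (cong indicator ∘ suc≟suc z)) (sum-indicator-≟ z)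
  where
  suc≟suc : ∀ {m} (z y : Fin m) → ⌊ suc z ≟ suc y ⌋ ≡ ⌊ z ≟ y ⌋
  suc≟suc z y with z ≟ y
  ... | yes _ = refl
  ... | no  _ = refl

sum-fibres : ∀ {d m} (g : Fin d → Fin m) → ∑[ y < m ] countF (λ x → ⌊ g x ≟ y ⌋) ≡ d
sum-fibres {d} {m} g = begin
  ∑[ y < m ] countF (λ x → ⌊ g x ≟ y ⌋)        ≡⟨ sum-cong-≗ (λ y → countF-sum (λ x → ⌊ g x ≟ y ⌋)) ⟩
  ∑[ y < m ] ∑[ x < d ] indicator ⌊ g x ≟ y ⌋  ≡⟨ ∑-comm (λ y x → indicator ⌊ g x ≟ y ⌋) ⟩
  ∑[ x < d ] ∑[ y < m ] indicator ⌊ g x ≟ y ⌋  ≡⟨ sum-cong-≗ (sum-indicator-≟ ∘ g) ⟩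
  ∑[ x < d ] 1                                 ≡⟨ sum-const d 1 ⟩
  d * 1                                        ≡⟨ *-identityʳ d ⟩
  d                                            ∎
  where open ≡-Reasoning

scaled-indicator-≤ : ∀ {k m} b → (T b → k ≤ m) → k * indicator b ≤ m
scaled-indicator-≤ {k} {m} true  k≤m = subst (_≤ m) (sym (*-identityʳ k)) (k≤m _)
scaled-indicator-≤ {k} {m} false _   = subst (_≤ m) (sym (*-zeroʳ k)) z≤n

iter-+ : ∀ {A : Set} (f : A → A) a b x → iter f (a + b) x ≡ iter f a (iter f b x)
iter-+ f zero    b x = refl
iter-+ f (suc a) b x = cong f (iter-+ f a b x)

iter-fixed : ∀ {A : Set} (f : A → A) {x} → f x ≡ x → ∀ k → iter f k x ≡ x
iter-fixed f fx≡x zero    = refl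
iter-fixed f fx≡x (suc k) = trans (cong f (iter-fixed f fx≡x k)) fx≡x

module Orbits {d} (F : Fin d → Fin d) (F-injective : Injective _≡_ _≡_ F) where

  _↝_ : Fin d → Fin d → Set
  x ↝ y = ∃ λ k → iter F k x ≡ y

  ↝-refl : ∀ {x} → x ↝ x
  ↝-refl = 0 , refl

  ↝-trans : ∀ {x y z} → x ↝ y → y ↝ z → x ↝ z
  ↝-trans {x} (k , refl) (l , refl) = l + k , iter-+ F l k x

  iter-injective : ∀ k → Injective _≡_ _≡_ (iter F k)
  iter-injective zero    eq = eq
  iter-injective (suc k) eq = iter-injective k (F-injective eq)

  iter-period-multiple : ∀ {p x} → iter F p x ≡ x → ∀ q → iter F (q * p) x ≡ x
  iter-period-multiple {p} {x} Fᵖx≡x zero    = refl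
  iter-period-multiple {p} {x} Fᵖx≡x (suc q) = begin
    iter F (p + q * p) x         ≡⟨ iter-+ F p (q * p) x ⟩
    iter F p (iter F (q * p) x)  ≡⟨ cong (iter F p) (iter-period-multiple Fᵖx≡x q) ⟩
    iter F p x                   ≡⟨ Fᵖx≡x ⟩
    x                            ∎
    where open ≡-Reasoning

  period : ∀ x → ∃ λ p → 0 < p × p ≤ d × iter F p x ≡ x
  period x with i , j , i<j , Fⁱx≡Fʲx ← pigeonhole (n<1+n d) (λ i → iter F (toℕ i) x) =
    toℕ j ∸ toℕ i , m<n⇒0<n∸m i<j , ≤-trans (m∸n≤m (toℕ j) (toℕ i)) (≤-pred (toℕ<n j)) ,
    iter-injective (toℕ i) (begin
      iter F (toℕ i) (iter F (toℕ j ∸ toℕ i) x)  ≡⟨ iter-+ F (toℕ i) (toℕ j ∸ toℕ i) x ⟨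
      iter F (toℕ i + (toℕ j ∸ toℕ i)) x         ≡⟨ cong (λ k → iter F k x) (m+[n∸m]≡n (<⇒≤ i<j)) ⟩
      iter F (toℕ j) x                           ≡⟨ Fⁱx≡Fʲx ⟨
      iter F (toℕ i) x                           ∎)
    where open ≡-Reasoning

  ↝-within : ∀ {x y} → x ↝ y → ∃ λ k → k < d × iter F k x ≡ y
  ↝-within {x} (k , refl) with suc p , _ , p≤d , Fᵖx≡x ← period x =
    r , ≤-trans (m%n<n k (suc p)) p≤d , (begin
      iter F r x                          ≡⟨ cong (iter F r) (iter-period-multiple Fᵖx≡x q) ⟨
      iter F r (iter F (q * suc p) x)     ≡⟨ iter-+ F r (q * suc p) x ⟨
      iter F (r + q * suc p) x            ≡⟨ cong (λ j → iter F j x) (m≡m%n+[m/n]*n k (suc p)) ⟨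
      iter F k x                          ∎)
    where
    open ≡-Reasoning
    r = k % suc p
    q = k / suc p

  ↝-sym : ∀ {x y} → x ↝ y → y ↝ x
  ↝-sym {x} (k , refl) with suc p , _ , _ , Fᵖx≡x ← period x =
    k * p , (begin
      iter F (k * p) (iter F k x)  ≡⟨ iter-+ F (k * p) k x ⟨
      iter F (k * p + k) x         ≡⟨ cong (λ j → iter F j x) (+-comm (k * p) k) ⟩
      iter F (k + k * p) x         ≡⟨ cong (λ j → iter F j x) (*-suc k p) ⟨
      iter F (k * suc p) x         ≡⟨ iter-period-multiple Fᵖx≡x k ⟩
      x                            ∎)
    where open ≡-Reasoning

  orbit : Fin d → List (Fin d)
  orbit x = map (λ k → iter F k x) (upTo d)

  orbitMin : Fin d → Fin d
  orbitMin x = argmin toℕ x (orbit x)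

  orbitMin-reachable : ∀ x → x ↝ orbitMin x
  orbitMin-reachable x =
    argmin-all toℕ {P = x ↝_} ↝-refl (All.map⁺ (universal (λ k → k , refl) (upTo d)))

  orbitMin-minimal : ∀ {x y} → x ↝ y → toℕ (orbitMin x) ≤ toℕ y
  orbitMin-minimal {x} x↝y with k , k<d , refl ← ↝-within x↝y =
    lookup (f[argmin]≤f[xs] {f = toℕ} x (orbit x)) (∈-map⁺ (λ k → iter F k x) (∈-upTo⁺ k<d))

  orbitMin-unique : ∀ {x m} → x ↝ m → (∀ {y} → x ↝ y → toℕ m ≤ toℕ y) → orbitMin x ≡ m
  orbitMin-unique x↝m m-minimal =
    toℕ-injective (≤-antisym (orbitMin-minimal x↝m) (m-minimal (orbitMin-reachable _)))

  orbitMin-iter : ∀ k x → orbitMin (iter F k x) ≡ orbitMin x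
  orbitMin-iter k x = orbitMin-unique
    (↝-trans (↝-sym (k , refl)) (orbitMin-reachable x))
    (λ Fᵏx↝y → orbitMin-minimal (↝-trans (k , refl) Fᵏx↝y))

module _ {A : Set} (f : A → A) {m} (no-short-cycle : ∀ z k → 0 < k → k < m → iter f k z ≢ z) where

  iter-distinct-below : ∀ x {a b : Fin m} → toℕ a < toℕ b → iter f (toℕ a) x ≢ iter f (toℕ b) x
  iter-distinct-below x {a} {b} a<b fᵃx≡fᵇx =
    no-short-cycle (iter f (toℕ a) x) (toℕ b ∸ toℕ a) (m<n⇒0<n∸m a<b)
      (≤-<-trans (m∸n≤m (toℕ b) (toℕ a)) (toℕ<n b)) (begin
        iter f (toℕ b ∸ toℕ a) (iter f (toℕ a) x)  ≡⟨ iter-+ f (toℕ b ∸ toℕ a) (toℕ a) x ⟨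
        iter f (toℕ b ∸ toℕ a + toℕ a) x           ≡⟨ cong (λ k → iter f k x) (m∸n+n≡m (<⇒≤ a<b)) ⟩
        iter f (toℕ b) x                           ≡⟨ fᵃx≡fᵇx ⟨
        iter f (toℕ a) x                           ∎)
    where open ≡-Reasoning

  iter-injective-below : ∀ x → Injective _≡_ _≡_ (λ (i : Fin m) → iter f (toℕ i) x)
  iter-injective-below x {i} {j} fⁱx≡fʲx with <-cmp (toℕ i) (toℕ j)
  ... | tri< i<j _ _ = contradiction fⁱx≡fʲx (iter-distinct-below x i<j)
  ... | tri≈ _ i≡j _ = toℕ-injective i≡j
  ... | tri> _ _ j<i = contradiction (sym fⁱx≡fʲx) (iter-distinct-below x j<i)

allBelow-sound : ∀ d p → T (allBelow d p) → ∀ k → k < d → T (p k)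
allBelow-sound (suc d) p all k k<1+d with Equivalence.to T-∧ all | m≤n⇒m<n∨m≡n k<1+d
... | all-below , _  | inj₁ (s≤s k<d) = allBelow-sound d p all-below k k<d
... | _ , pd         | inj₂ refl      = pd

third-element : ∀ {n} → 3 ≤ n → (u v : Fin n) → ∃ λ a → a ≢ u × a ≢ v
third-element (s≤s (s≤s (s≤s _))) u v with zero ≟ u | zero ≟ v
... | no 0≢u   | no 0≢v   = zero , 0≢u , 0≢v
... | yes refl | yes refl = suc zero , (λ ()) , (λ ())
... | yes refl | no _ with suc zero ≟ v
...   | no 1≢v   = suc zero , (λ ()) , 1≢v
...   | yes refl = suc (suc zero) , (λ ()) , (λ ())
third-element (s≤s (s≤s (s≤s _))) u v | no _ | yes refl with suc zero ≟ u
...   | no 1≢u   = suc zero , 1≢u , (λ ())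
...   | yes refl = suc (suc zero) , (λ ()) , (λ ())

module _ {n d} (B : PlaneGraph n d) where
  open PlaneGraph B

  φ-injective : Injective _≡_ _≡_ φ
  φ-injective {x} {y} φx≡φy = begin
    x                      ≡⟨ rev-invol x ⟨
    rev (rev x)            ≡⟨ cong rev (prev-next (rev x)) ⟨
    rev (prev (φ x))       ≡⟨ cong (rev ∘ prev) φx≡φy ⟩
    rev (prev (φ y))       ≡⟨ cong rev (prev-next (rev y)) ⟩
    rev (rev y)            ≡⟨ rev-invol y ⟩
    y                      ∎
    where open ≡-Reasoning

  LonelyDart : Fin d → Set
  LonelyDart x = ∀ y → tail y ≡ tail x → y ≡ x

  -- Removing the new vertex and head x from G⁺ would cut tail x off from any third vertex.
  circuit⇒¬lonely : IsCircuitGraph → ∀ x → ¬ LonelyDart x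
  circuit⇒¬lonely (3<1+n , connected) x lonely =
    a≢v (suc-injective (stuck (connected S (s≤s (s≤s (s≤s z≤n))) (suc v) (suc a) v∉S a∉S)))
    where
    v = tail x
    u = head x
    S : List (Fin (suc n))
    S = zero ∷ suc u ∷ []
    third = third-element (≤-pred 3<1+n) u v
    a = proj₁ third
    a≢v = proj₂ (proj₂ third)
    a∉S : suc a ∉ S
    a∉S (there (here 1+a≡1+u)) = proj₁ (proj₂ third) (suc-injective 1+a≡1+u)
    v∉S : suc v ∉ S
    v∉S (there (here 1+v≡1+u)) = no-loop x (sym (suc-injective 1+v≡1+u))
    Allowed : Fin (suc n) → Set
    Allowed w = w ∉ S
    start-allowed : ∀ {s t} → ReachIn AdjPlus Allowed s t → Allowed s
    start-allowed (here s∉S)       = s∉S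
    start-allowed (step s∉S _ _)   = s∉S
    stuck : ∀ {t} → ReachIn AdjPlus Allowed (suc v) t → t ≡ suc v
    stuck (here _) = refl
    stuck (step {w = zero} _ _ rest) = contradiction (here refl) (start-allowed rest)
    stuck (step {w = suc w} _ (y , tail-y , head-y) rest) =
      contradiction (there (here (cong suc (trans (sym head-y) (cong head (lonely y tail-y))))))
                    (start-allowed rest)

  open Orbits φ φ-injective using (_↝_; ↝-refl; ↝-within; orbitMin; orbitMin-unique; orbitMin-iter)

  face : Fin d → Fin d
  face = orbitMin

  -- Zero unless y is the least dart of its face.
  faceLength : Fin d → ℕ
  faceLength y = countF (λ x → ⌊ face x ≟ y ⌋)

  face-iter : ∀ k x → face (iter φ k x) ≡ face x
  face-iter = orbitMin-iter

  face-rep : ∀ {y} → T (isFaceRep y) → face y ≡ y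
  face-rep {y} rep = orbitMin-unique ↝-refl minimal
    where
    minimal : ∀ {z} → y ↝ z → toℕ y ≤ toℕ z
    minimal y↝z with k , k<d , refl ← ↝-within y↝z =
      ≤ᵇ⇒≤ _ _ (allBelow-sound d _ rep k k<d)

  External? : ∀ v → Dec (External v)
  External? v = map′ (λ (k , φᵏo) → toℕ k , φᵏo) shortcut
    (any? (λ k → tail (iter φ (toℕ k) outer) ≟ v))
    where
    shortcut : External v → ∃ λ (k : Fin d) → tail (iter φ (toℕ k) outer) ≡ v
    shortcut (k , refl) with j , j<d , φʲo≡φᵏo ← ↝-within (k , refl) =
      fromℕ< j<d , cong tail (trans (cong (λ i → iter φ i outer) (toℕ-fromℕ< j<d)) φʲo≡φᵏo)

  isExternal : Fin n → Bool
  isExternal v = ⌊ External? v ⌋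

  outer-face-length : countF isExternal ≤ faceLength (face outer)
  outer-face-length =
    injective⇒≤countF _ visit visit-injective (λ i → fromWitness (face-iter (steps i) outer))
    where
    steps : Fin (countF isExternal) → ℕ
    steps i = proj₁ (toWitness (enumerate-sound isExternal i))
    visit : Fin (countF isExternal) → Fin d
    visit i = iter φ (steps i) outer
    visit-injective : Injective _≡_ _≡_ visit
    visit-injective {i} {j} eq = enumerate-injective isExternal i j (begin
      enumerate isExternal i  ≡⟨ proj₂ (toWitness (enumerate-sound isExternal i)) ⟨
      tail (visit i)          ≡⟨ cong tail eq ⟩
      tail (visit j)          ≡⟨ proj₂ (toWitness (enumerate-sound isExternal j)) ⟩
      enumerate isExternal j  ∎)
      where open ≡-Reasoning

  isExternalOfDegree2 : Fin n → Bool
  isExternalOfDegree2 v = isExternal v ∧ ⌊ degree v ℕ.≟ 2 ⌋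

  isExternalOfDegree2-sound : ∀ {v} → T (isExternalOfDegree2 v) → External v × degree v ≡ 2
  isExternalOfDegree2-sound {v} t
    with external , degree≡2 ← Equivalence.to (T-∧ {isExternal v}) t =
    toWitness external , toWitness degree≡2

  colour-iter : (c : Fin n → Bool) → (∀ x → c (tail x) ≢ c (head x)) →
                ∀ k x → c (tail (iter φ k x)) ≡ iter not k (c (tail x))
  colour-iter c proper zero    x = refl
  colour-iter c proper (suc k) x = begin
    c (tail (next (rev (iter φ k x))))  ≡⟨ cong c (next-tail (rev (iter φ k x))) ⟩
    c (head (iter φ k x))               ≡⟨ ¬-not (≢-sym (proper (iter φ k x))) ⟩
    not (c (tail (iter φ k x)))         ≡⟨ cong not (colour-iter c proper k x) ⟩
    not (iter not k (c (tail x)))       ∎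
    where open ≡-Reasoning

  module _ (circuit : IsCircuitGraph) where

    degree≥2 : ∀ v → 2 ≤ degree v
    degree≥2 v with x , refl ← tail-surj v | 2 ≤? degree v
    ... | yes 2≤deg = 2≤deg
    ... | no  2≰deg = contradiction lonely (circuit⇒¬lonely circuit x)
      where
      lonely : LonelyDart x
      lonely y tail-y≡v with y ≟ x
      ... | yes y≡x = y≡x
      ... | no  y≢x = contradiction (injective⇒≤countF _ pair pair-injective pair-at-v) 2≰deg
        where
        pair : Fin 2 → Fin d
        pair zero       = x
        pair (suc zero) = y
        pair-injective : Injective _≡_ _≡_ pair
        pair-injective {zero}     {zero}     _   = refl
        pair-injective {zero}     {suc zero} x≡y = contradiction (sym x≡y) y≢x
        pair-injective {suc zero} {zero}     y≡x = contradiction y≡x y≢x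
        pair-injective {suc zero} {suc zero} _   = refl
        pair-at-v : ∀ i → T ⌊ tail (pair i) ≟ tail x ⌋
        pair-at-v zero       = fromWitness refl
        pair-at-v (suc zero) = fromWitness tail-y≡v

    -- φ (φ x) ≡ x would make φ x parallel to rev x, leaving rev x alone at its tail.
    digon-free : ∀ x → φ (φ x) ≢ x
    digon-free x φφx≡x = circuit⇒¬lonely circuit (rev x) lonely
      where
      next-fixes-rev : next (rev x) ≡ rev x
      next-fixes-rev = no-multi (φ x) (rev x) (next-tail (rev x)) (begin
        tail (rev (φ x))          ≡⟨ next-tail (rev (φ x)) ⟨
        tail (φ (φ x))            ≡⟨ cong tail φφx≡x ⟩
        tail x                    ≡⟨ cong tail (rev-invol x) ⟨
        tail (rev (rev x))        ∎)
        where open ≡-Reasoning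
      lonely : LonelyDart (rev x)
      lonely y tail-y with k , nextᵏ≡y ← next-cyc (rev x) y (sym tail-y) =
        trans (sym nextᵏ≡y) (iter-fixed next next-fixes-rev k)

    vertex-charge : (∀ v → Internal v → degree v ≥ 4) → ∀ v →
                    4 ≤ degree v + indicator (isExternal v) + indicator (isExternalOfDegree2 v)
    vertex-charge interior v with External? v
    ... | no internal = ≤-trans (interior v internal) (≤-trans (m≤m+n _ 0) (m≤m+n _ 0))
    ... | yes _ with degree v ℕ.≟ 2
    ...   | yes deg≡2 = subst (λ k → 4 ≤ k + 1 + 1) (sym deg≡2) ≤-refl
    ...   | no  deg≢2 = ≤-trans (+-monoˡ-≤ 1 (≤∧≢⇒< (degree≥2 v) (deg≢2 ∘ sym))) (m≤m+n _ 0)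

    vertices-bound : (∀ v → Internal v → degree v ≥ 4) →
                     n * 4 ≤ d + countF isExternal + countF isExternalOfDegree2
    vertices-bound interior = begin
      n * 4
        ≡⟨ sum-const n 4 ⟨
      ∑[ v < n ] 4
        ≤⟨ sum-mono-≤ _ _ (vertex-charge interior) ⟩
      ∑[ v < n ] (degree v + ext v + ext₂ v)
        ≡⟨ ∑-distrib-+ (λ v → degree v + ext v) ext₂ ⟩
      ∑[ v < n ] (degree v + ext v) + sum ext₂
        ≡⟨ cong (_+ sum ext₂) (∑-distrib-+ degree ext) ⟩
      sum degree + sum ext + sum ext₂
        ≡⟨ cong₂ (λ a b → a + b + sum ext₂) (sum-fibres tail) (sym (countF-sum isExternal)) ⟩
      d + countF isExternal + sum ext₂
        ≡⟨ cong (d + countF isExternal +_) (countF-sum isExternalOfDegree2) ⟨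
      d + countF isExternal + countF isExternalOfDegree2
        ∎
      where
      open ≤-Reasoning
      ext ext₂ : Fin n → ℕ
      ext  = indicator ∘ isExternal
      ext₂ = indicator ∘ isExternalOfDegree2

    module _ (bipartite : IsBipartite) where

      colour : Fin n → Bool
      colour = proj₁ bipartite

      colour-return : ∀ k x → iter φ k x ≡ x → colour (tail x) ≡ iter not k (colour (tail x))
      colour-return k x φᵏx≡x =
        trans (cong (colour ∘ tail) (sym φᵏx≡x)) (colour-iter colour (proj₂ bipartite) k x)

      φ-no-short-cycle : ∀ x k → 0 < k → k < 4 → iter φ k x ≢ x
      φ-no-short-cycle x 1 _ _ φx≡x  = not-¬ refl (colour-return 1 x φx≡x)
      φ-no-short-cycle x 2 _ _       = digon-free x
      φ-no-short-cycle x 3 _ _ φ³x≡x =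
        not-¬ refl (trans (colour-return 3 x φ³x≡x) (not-involutive _))
      φ-no-short-cycle x (suc (suc (suc (suc _)))) _ (s≤s (s≤s (s≤s (s≤s ()))))

      faceLength≥4 : ∀ {y} → T (isFaceRep y) → 4 ≤ faceLength y
      faceLength≥4 {y} rep = injective⇒≤countF _ (λ i → iter φ (toℕ i) y)
        (iter-injective-below φ φ-no-short-cycle y)
        (λ i → fromWitness (trans (face-iter (toℕ i) y) (face-rep rep)))

      face-charge : ∀ y → 4 * indicator (isFaceRep y) ≤ faceLength y
      face-charge y = scaled-indicator-≤ (isFaceRep y) faceLength≥4

      faces-bound : 4 * numFaces + countF isExternal ≤ 4 + d
      faces-bound = begin
        4 * numFaces + countF isExternal
          ≡⟨ cong (λ f → 4 * f + countF isExternal) (countF-sum isFaceRep) ⟩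
        4 * sum (indicator ∘ isFaceRep) + countF isExternal
          ≡⟨ cong (_+ countF isExternal) (*-distribˡ-sum 4 (indicator ∘ isFaceRep)) ⟩
        sum charge + countF isExternal
          ≤⟨ sum-≤-exchange charge faceLength (face outer) face-charge
               (scaled-indicator-≤ (isFaceRep (face outer)) (λ _ → ≤-refl)) outer-face-length ⟩
        4 + sum faceLength
          ≡⟨ cong (4 +_) (sum-fibres face) ⟩
        4 + d
          ∎
        where
        open ≤-Reasoning
        charge : Fin d → ℕ
        charge y = 4 * indicator (isFaceRep y)

euler-charge : ∀ {n f d x k} → 2 * n + 2 * f ≡ 4 + d → n * 4 ≤ d + x + k → 4 * f + x ≤ 4 + d → 4 ≤ k
euler-charge {n} {f} {d} {x} {k} euler vertices faces = +-cancelˡ-≤ (d + d + x + 4) 4 k (begin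
  d + d + x + 4 + 4          ≡⟨ solve (d ∷ x ∷ []) ⟩
  2 * (4 + d) + x            ≡⟨ cong (λ m → 2 * m + x) euler ⟨
  2 * (2 * n + 2 * f) + x    ≡⟨ solve (n ∷ f ∷ x ∷ []) ⟩
  n * 4 + (4 * f + x)        ≤⟨ +-mono-≤ vertices faces ⟩
  d + x + k + (4 + d)        ≡⟨ solve (d ∷ x ∷ k ∷ []) ⟩
  d + d + x + 4 + k          ∎)
  where open ≤-Reasoning

lemma2 : ∀ {n d : ℕ} (B : PlaneGraph n d) →
    PlaneGraph.IsBipartite B →
    PlaneGraph.IsCircuitGraph B →
    (∀ v → PlaneGraph.Internal B v → PlaneGraph.degree B v ≥ 4) →
    Σ (Fin 4 → Fin n) λ f → Injective _≡_ _≡_ f ×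
      (∀ i → PlaneGraph.External B (f i) × PlaneGraph.degree B (f i) ≡ 2)
lemma2 {n} B bipartite circuit interior =
  let f , f-injective , f-sound = ≤countF⇒injection (isExternalOfDegree2 B) four-of-them
  in  f , f-injective , isExternalOfDegree2-sound B ∘ f-sound
  where
  four-of-them : 4 ≤ countF (isExternalOfDegree2 B)
  four-of-them = euler-charge {n} {PlaneGraph.numFaces B} (PlaneGraph.euler B)
    (vertices-bound B circuit interior) (faces-bound B circuit bipartite)
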